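{- Let $G$ be a connected strongly regular graph with parameters $(n,k,\lambda,\mu)$, with $k\geq 3$, and suppose that $\lambda=0$ or $\lambda=1$. Then the Gallai graph $\Gamma(G)$ is $2$-connected.
   Context: All graphs are finite and simple. A $k$-regular graph $G$ on $n$ vertices is strongly regular with parameters $(n,k,\lambda,\mu)$ if $G$ is neither complete nor empty, any two adjacent vertices have exactly $\lambda$ common neighbours, and any two non-adjacent vertices have exactly $\mu$ common neighbours. The Gallai graph $\Gamma(G)$ has the edges of $G$ as vertices, two being adjacent iff the corresponding edges of $G$ share a vertex but do not lie on a common triangle of $G$. A graph is $2$-connected if it is connected and removing any single vertex leaves it connected. -}

module Defs where

open import Data.Nat using (ℕ; zero; suc; _+_; _≤_)
open import Data.Fin using (Fin) renaming (_<_ to _<ᶠ_)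
open import Data.Bool using (Bool; true; false; if_then_else_; _∧_)
open import Data.List using (List; map; allFin)
open import Data.Nat.ListAction using (sum)
open import Data.Product using (Σ; ∃; _×_; _,_; proj₁)
open import Data.Sum using (_⊎_)
open import Relation.Nullary using (¬_)
open import Relation.Binary.PropositionalEquality using (_≡_; _≢_)
open import Relation.Binary.Construct.Closure.ReflexiveTransitive using (Star)

record Graph (n : ℕ) : Set where
  field
    adj   : Fin n → Fin n → Bool
    sym   : ∀ u v → adj u v ≡ adj v u
    irrefl : ∀ v → adj v v ≡ false
open Graph public

module _ {n : ℕ} (G : Graph n) where

  Adj : Fin n → Fin n → Set
  Adj u v = adj G u v ≡ true

  degree : Fin n → ℕ
  degree v = sum (map (λ w → if adj G v w then 1 else 0) (allFin n))

  commonNbrs : Fin n → Fin n → ℕ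
  commonNbrs u v = sum (map (λ w → if adj G u w ∧ adj G v w then 1 else 0) (allFin n))

  IsSRG : ℕ → ℕ → ℕ → Set
  IsSRG k l m =
      (∀ v → degree v ≡ k)
    × (∃ λ u → ∃ λ v → u ≢ v × adj G u v ≡ false)
    × (∃ λ u → ∃ λ v → Adj u v)
    × (∀ u v → Adj u v → commonNbrs u v ≡ l)
    × (∀ u v → u ≢ v → adj G u v ≡ false → commonNbrs u v ≡ m)

  GraphConnected : Set
  GraphConnected = ∀ u v → Star Adj u v

  Edge : Set
  Edge = Σ (Fin n × Fin n) λ p → (proj₁ p <ᶠ Data.Product.proj₂ p) × Adj (proj₁ p) (Data.Product.proj₂ p)

  ends : Edge → Fin n × Fin n
  ends = proj₁

  _∈E_ : Fin n → Edge → Set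
  x ∈E ((a , b) , _) = (x ≡ a) ⊎ (x ≡ b)

  InTriple : Edge → Fin n → Fin n → Fin n → Set
  InTriple e x y z = ∀ w → w ∈E e → (w ≡ x) ⊎ (w ≡ y) ⊎ (w ≡ z)

  CommonTriangle : Edge → Edge → Set
  CommonTriangle e f = ∃ λ x → ∃ λ y → ∃ λ z →
    Adj x y × Adj y z × Adj x z × InTriple e x y z × InTriple f x y z

  GallaiAdj : Edge → Edge → Set
  GallaiAdj e f = ends e ≢ ends f × (∃ λ x → x ∈E e × x ∈E f) × ¬ CommonTriangle e f

Connected : (V : Set) → (V → V → Set) → Set
Connected V E = ∀ x y → Star E x y

TwoConnected : (V : Set) → (V → V → Set) → Set
TwoConnected V E = Connected V E × (∀ v → Connected (Σ V (λ x → x ≢ v)) (λ a b → E (proj₁ a) (proj₁ b)))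

module Submission where

-- Fix an edge e of G and work in Γ(G) − e.  Two edges va, vb at a vertex v are
-- Gallai-adjacent unless a = b or a ~ b; then they are joined through an edge vc
-- with c distinct from and nonadjacent to a and b.  If v has two such exits c, one
-- of the edges vc is not e, so all edges at a vertex lie in one component of
-- Γ(G) − e.  Walking in G − e, which is connected as long as every edge of G lies on
-- a cycle, then connects any two edges.  For λ = 0 the exits come from triangle-
-- freeness and k ≥ 3, and the cycles from μ ≥ 1 (connectivity of G); for λ = 1
-- every edge lies in exactly one triangle, which provides both.  Γ(G) itself is
-- connected because any two edges are avoided by a third.

open import Defs
open import Data.Nat using (ℕ; _≤_; _<_; z≤n; s≤s; s≤s⁻¹)
open import Data.Nat.Properties using (≤-refl; ≤-trans; m≤n⇒m≤1+n; 1+n≰n)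
open import Data.Nat.ListAction using (sum)
open import Data.Fin using (Fin)
open import Data.Fin.Properties using (_≟_; <-cmp; <-irrefl; <-asym; <-irrelevant)
open import Data.Bool using (Bool; true; false; if_then_else_; _∧_)
import Data.Bool.Properties as Bool
open import Data.List using (List; []; _∷_; map; length; filter)
open import Data.List.Properties using (filter-notAll)
open import Data.List.Membership.Propositional using (_∈_; _∉_)
open import Data.List.Membership.Propositional.Properties using (∈-filter⁺; ∈-allFin)
open import Data.List.Relation.Unary.Any as Any using (here; there)
open import Data.List.Relation.Unary.All as All using ()
open import Data.List.Relation.Unary.AllPairs using (_∷_)
open import Data.List.Relation.Unary.Unique.Propositional using (Unique)
open import Data.List.Relation.Unary.Unique.Propositional.Properties using (allFin⁺)
open import Data.Product using (Σ; ∃; ∃₂; _×_; _,_; proj₁; proj₂; swap)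
import Data.Product as Product
open import Data.Product.Properties using (≡-dec)
open import Data.Sum using (_⊎_; inj₁; inj₂; [_,_]′)
import Data.Sum as Sum
open import Function using (_∘_)
open import Data.Empty using (⊥; ⊥-elim)
open import Relation.Nullary using (¬_; Dec; yes; no; ¬?; _×-dec_; _⊎-dec_)
open import Relation.Nullary.Decidable using (map′)
open import Relation.Binary.Definitions using (DecidableEquality; tri<; tri≈; tri>)
open import Relation.Binary.PropositionalEquality
  using (_≡_; _≢_; refl; trans; cong; cong₂; subst) renaming (sym to ≡-sym)
open import Relation.Binary.Construct.Closure.ReflexiveTransitive
  using (Star; ε; _◅_; _◅◅_; gmap; reverse; _⋆)
open import Axiom.UniquenessOfIdentityProofs using (module Decidable⇒UIP)

connected-if-deletions-connected : {V : Set} {E : V → V → Set} →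
  (∀ x y → ∃ λ v → x ≢ v × y ≢ v) →
  (∀ v → Connected (Σ V (λ x → x ≢ v)) (λ a b → E (proj₁ a) (proj₁ b))) →
  Connected V E
connected-if-deletions-connected avoid connected x y with avoid x y
... | v , x≢v , y≢v = gmap proj₁ (λ step → step) (connected v (x , x≢v) (y , y≢v))

module Counting {n : ℕ} where
  open import Data.List.Membership.DecPropositional (_≟_ {n = n}) using (_∈?_)

  count : (Fin n → Bool) → List (Fin n) → ℕ
  count f xs = sum (map (λ w → if f w then 1 else 0) xs)

  count-pos : ∀ f {xs w} → w ∈ xs → f w ≡ true → 1 ≤ count f xs
  count-pos f (here refl) fw rewrite fw = s≤s z≤n
  count-pos f {x ∷ _} (there w∈xs) fw with f x
  ... | true = s≤s z≤n
  ... | false = count-pos f w∈xs fw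

  count-two : ∀ f {xs w w′} → w ∈ xs → w′ ∈ xs → w ≢ w′ → f w ≡ true → f w′ ≡ true →
              2 ≤ count f xs
  count-two f (here refl) (here refl) w≢w′ _ _ = ⊥-elim (w≢w′ refl)
  count-two f (here refl) (there w′∈xs) _ fw fw′ rewrite fw = s≤s (count-pos f w′∈xs fw′)
  count-two f (there w∈xs) (here refl) _ fw fw′ rewrite fw′ = s≤s (count-pos f w∈xs fw)
  count-two f {x ∷ _} (there w∈xs) (there w′∈xs) w≢w′ fw fw′ with f x
  ... | true = m≤n⇒m≤1+n (count-two f w∈xs w′∈xs w≢w′ fw fw′)
  ... | false = count-two f w∈xs w′∈xs w≢w′ fw fw′

  -- When x is counted but lies in ys, recurse with every copy of x deleted from ys.
  witness-avoiding : ∀ f {xs} → Unique xs → (ys : List (Fin n)) → length ys < count f xs →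
                     ∃ λ w → w ∈ xs × f w ≡ true × w ∉ ys
  witness-avoiding f {x ∷ xs} (x∉xs ∷ xs!) ys ys<count with f x in fx
  ... | false = Product.map₂ (Product.map₁ there) (witness-avoiding f xs! ys ys<count)
  ... | true with x ∈? ys
  ...   | no x∉ys = x , here refl , fx , x∉ys
  ...   | yes x∈ys with witness-avoiding f xs! (filter (λ y → ¬? (x ≟ y)) ys)
                         (≤-trans (filter-notAll (λ y → ¬? (x ≟ y)) ys (Any.map (λ x≡y x≢y → x≢y x≡y) x∈ys))
                                  (s≤s⁻¹ ys<count))
  ...     | w , w∈xs , fw , w∉ys-x =
    w , there w∈xs , fw , λ w∈ys → w∉ys-x (∈-filter⁺ (λ y → ¬? (x ≟ y)) w∈ys (All.lookup x∉xs w∈xs))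

∧-≡true : ∀ {a b} → a ∧ b ≡ true → a ≡ true × b ≡ true
∧-≡true {true} {true} refl = refl , refl

≡true-∧ : ∀ {a b} → a ≡ true → b ≡ true → a ∧ b ≡ true
≡true-∧ refl refl = refl

module Graphs {n : ℕ} (G : Graph n) where
  open Counting {n}

  private
    variable
      u v w x y z a b c d : Fin n
      w′ : Fin n
      h h′ : Edge G

  adj-sym : Adj G u v → Adj G v u
  adj-sym {u} {v} uv = trans (Graph.sym G v u) uv

  adj⇒≢ : Adj G u v → u ≢ v
  adj⇒≢ {u} uu refl with trans (≡-sym (irrefl G u)) uu
  ... | ()

  Nonadj : Fin n → Fin n → Set
  Nonadj a b = a ≢ b × ¬ Adj G a b

  nonadj-sym : Nonadj a b → Nonadj b a
  nonadj-sym (a≢b , ¬ab) = a≢b ∘ ≡-sym , ¬ab ∘ adj-sym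

  nonadj⇒adj≡false : Nonadj a b → adj G a b ≡ false
  nonadj⇒adj≡false (_ , ¬ab) = Bool.¬-not ¬ab

  TriangleFree : Set
  TriangleFree = ∀ {x y z} → Adj G x y → Adj G y z → Adj G x z → ⊥

  _∈ᴱ_ : Fin n → Edge G → Set
  _∈ᴱ_ = _∈E_ G

  _∈ᴱ?_ : ∀ w h → Dec (w ∈ᴱ h)
  w ∈ᴱ? ((a , b) , _) = (w ≟ a) ⊎-dec (w ≟ b)

  ends-injective : ends G h ≡ ends G h′ → h ≡ h′
  ends-injective {(a , b) , a<b , ab} {(.a , .b) , a<b′ , ab′} refl =
    cong₂ (λ lt p → (a , b) , lt , p) (<-irrelevant a<b a<b′) (Decidable⇒UIP.≡-irrelevant Bool._≟_ ab ab′)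

  _≟ᴱ_ : DecidableEquality (Edge G)
  h ≟ᴱ h′ = map′ ends-injective (cong (ends G)) (≡-dec _≟_ _≟_ (ends G h) (ends G h′))

  endpoints⊆⇒≡ : (∀ {w} → w ∈ᴱ h → w ∈ᴱ h′) → h ≡ h′
  endpoints⊆⇒≡ {(a , b) , a<b , _} {(a′ , b′) , a′<b′ , _} h⊆h′ with h⊆h′ (inj₁ refl) | h⊆h′ (inj₂ refl)
  ... | inj₁ refl | inj₁ refl = ⊥-elim (<-irrefl refl a<b)
  ... | inj₁ refl | inj₂ refl = ends-injective refl
  ... | inj₂ refl | inj₁ refl = ⊥-elim (<-asym a<b a′<b′)
  ... | inj₂ refl | inj₂ refl = ⊥-elim (<-irrefl refl a<b)

  ∉-endpoint⇒≢ : w ∈ᴱ h → ¬ w ∈ᴱ h′ → h ≢ h′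
  ∉-endpoint⇒≢ w∈h w∉h′ refl = w∉h′ w∈h

  record Joins (h : Edge G) (v a : Fin n) : Set where
    field
      adjacent : Adj G v a
      left∈    : v ∈ᴱ h
      right∈   : a ∈ᴱ h
      endpoint : ∀ {w} → w ∈ᴱ h → w ≡ v ⊎ w ≡ a
  open Joins

  edge : Adj G v a → Σ (Edge G) λ h → Joins h v a
  edge {v} {a} va with <-cmp v a
  ... | tri< v<a _ _ = ((v , a) , v<a , va) , record
    { adjacent = va ; left∈ = inj₁ refl ; right∈ = inj₂ refl ; endpoint = λ w∈h → w∈h }
  ... | tri≈ _ v≡a _ = ⊥-elim (adj⇒≢ va v≡a)
  ... | tri> _ _ a<v = ((a , v) , a<v , adj-sym va) , record
    { adjacent = va ; left∈ = inj₂ refl ; right∈ = inj₁ refl ; endpoint = Sum.swap }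

  joins : v ∈ᴱ h → ∃ (Joins h v)
  joins {h = (a , b) , _ , ab} (inj₁ refl) = b , record
    { adjacent = ab ; left∈ = inj₁ refl ; right∈ = inj₂ refl ; endpoint = λ w∈h → w∈h }
  joins {h = (a , b) , _ , ab} (inj₂ refl) = a , record
    { adjacent = adj-sym ab ; left∈ = inj₂ refl ; right∈ = inj₁ refl ; endpoint = Sum.swap }

  joins-unique : Joins h v a → Joins h′ v a → h ≡ h′
  joins-unique J J′ = endpoints⊆⇒≡ λ w∈h → [ (λ { refl → left∈ J′ }) , (λ { refl → right∈ J′ }) ]′ (endpoint J w∈h)

  joins-≢ : Joins h v a → Joins h′ v b → a ≢ b → h ≢ h′
  joins-≢ J J′ a≢b = ∉-endpoint⇒≢ (right∈ J)
    λ a∈h′ → [ adj⇒≢ (adjacent J) ∘ ≡-sym , a≢b ]′ (endpoint J′ a∈h′)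

  neighbour-avoiding : 3 ≤ degree G v → ∀ a b → ∃ λ c → Adj G v c × c ≢ a × c ≢ b
  neighbour-avoiding {v} 3≤deg a b with witness-avoiding (adj G v) (allFin⁺ n) (a ∷ b ∷ []) 3≤deg
  ... | c , _ , vc , c∉ab = c , vc , c∉ab ∘ here , c∉ab ∘ there ∘ here

  common-neighbour : 1 ≤ commonNbrs G u v → ∃ λ w → Adj G u w × Adj G v w
  common-neighbour {u} {v} 1≤common with witness-avoiding (λ w → adj G u w ∧ adj G v w) (allFin⁺ n) [] 1≤common
  ... | w , _ , uvw , _ = w , ∧-≡true uvw

  one≤commonNbrs : Adj G u w → Adj G v w → 1 ≤ commonNbrs G u v
  one≤commonNbrs {u = u} {w = w} {v = v} uw vw =
    count-pos (λ w → adj G u w ∧ adj G v w) (∈-allFin w) (≡true-∧ uw vw)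

  two≤commonNbrs : Adj G u w → Adj G v w → Adj G u w′ → Adj G v w′ → w ≢ w′ → 2 ≤ commonNbrs G u v
  two≤commonNbrs {u = u} {w = w} {v = v} {w′ = w′} uw vw uw′ vw′ w≢w′ =
    count-two (λ w → adj G u w ∧ adj G v w) (∈-allFin w) (∈-allFin w′) w≢w′ (≡true-∧ uw vw) (≡true-∧ uw′ vw′)

  triangle-adj : Adj G x y → Adj G y z → Adj G x z → a ≢ b →
                 (a ≡ x ⊎ a ≡ y ⊎ a ≡ z) → (b ≡ x ⊎ b ≡ y ⊎ b ≡ z) → Adj G a b
  triangle-adj xy yz xz a≢b (inj₁ refl) (inj₁ refl) = ⊥-elim (a≢b refl)
  triangle-adj xy yz xz a≢b (inj₁ refl) (inj₂ (inj₁ refl)) = xy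
  triangle-adj xy yz xz a≢b (inj₁ refl) (inj₂ (inj₂ refl)) = xz
  triangle-adj xy yz xz a≢b (inj₂ (inj₁ refl)) (inj₁ refl) = adj-sym xy
  triangle-adj xy yz xz a≢b (inj₂ (inj₁ refl)) (inj₂ (inj₁ refl)) = ⊥-elim (a≢b refl)
  triangle-adj xy yz xz a≢b (inj₂ (inj₁ refl)) (inj₂ (inj₂ refl)) = yz
  triangle-adj xy yz xz a≢b (inj₂ (inj₂ refl)) (inj₁ refl) = adj-sym xz
  triangle-adj xy yz xz a≢b (inj₂ (inj₂ refl)) (inj₂ (inj₁ refl)) = adj-sym yz
  triangle-adj xy yz xz a≢b (inj₂ (inj₂ refl)) (inj₂ (inj₂ refl)) = ⊥-elim (a≢b refl)

  gallai-adj : Joins h v a → Joins h′ v b → Nonadj a b → GallaiAdj G h h′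
  gallai-adj J J′ (a≢b , ¬ab) =
    joins-≢ J J′ a≢b ∘ ends-injective ,
    (_ , left∈ J , left∈ J′) ,
    λ { (x , y , z , xy , yz , xz , h⊆xyz , h′⊆xyz) →
          ¬ab (triangle-adj xy yz xz a≢b (h⊆xyz _ (right∈ J)) (h′⊆xyz _ (right∈ J′))) }

  AdjWithout : Edge G → Fin n → Fin n → Set
  AdjWithout e s t = Adj G s t × ¬ (s ∈ᴱ e × t ∈ᴱ e)

  off-left : ∀ e {s t} → Adj G s t → ¬ s ∈ᴱ e → AdjWithout e s t
  off-left e st s∉e = st , s∉e ∘ proj₁

  off-right : ∀ e {s t} → Adj G s t → ¬ t ∈ᴱ e → AdjWithout e s t
  off-right e st t∉e = st , t∉e ∘ proj₂

  adj-without-sym : ∀ {e s t} → AdjWithout e s t → AdjWithout e t s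
  adj-without-sym (st , ¬both) = adj-sym st , ¬both ∘ swap

  Bridgeless : Set
  Bridgeless = ∀ e → Star (AdjWithout e) (proj₁ (ends G e)) (proj₂ (ends G e))

  detour : Bridgeless → ∀ e → Adj G u v → Star (AdjWithout e) u v
  detour {u} {v} bridgeless e uv with u ∈ᴱ? e ×-dec v ∈ᴱ? e
  ... | no ¬both = (uv , ¬both) ◅ ε
  detour bridgeless e@((a , b) , _) uv | yes (u∈e , v∈e) with u∈e | v∈e
  ... | inj₁ refl | inj₁ refl = ⊥-elim (adj⇒≢ uv refl)
  ... | inj₁ refl | inj₂ refl = bridgeless e
  ... | inj₂ refl | inj₁ refl = reverse (adj-without-sym {e = e}) (bridgeless e)
  ... | inj₂ refl | inj₂ refl = ⊥-elim (adj⇒≢ uv refl)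

  connected-without-edge : GraphConnected G → Bridgeless → ∀ e u v → Star (AdjWithout e) u v
  connected-without-edge connected bridgeless e u v = (detour bridgeless e ⋆) (connected u v)

  TwoExits : Fin n → (Fin n → Set) → Set
  TwoExits v P = ∃₂ λ c d → c ≢ d × Adj G v c × Adj G v d × P c × P d

  two-exits-map : {P Q : Fin n → Set} → (∀ {c} → P c → Q c) → TwoExits v P → TwoExits v Q
  two-exits-map f (c , d , c≢d , vc , vd , Pc , Pd) = c , d , c≢d , vc , vd , f Pc , f Pd

  record Exits : Set where
    field
      at-edge     : Adj G v a → TwoExits v (Nonadj a)
      at-triangle : Adj G v a → Adj G v b → Adj G a b → TwoExits v (λ c → Nonadj a c × Nonadj b c)

  module GallaiWithout (exits : Exits) (e : Edge G) where
    open Exits exits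

    Node : Set
    Node = Σ (Edge G) (λ h → h ≢ e)

    _∼_ : Node → Node → Set
    x ∼ y = GallaiAdj G (proj₁ x) (proj₁ y)

    two-steps : (x y z : Node) → x ∼ y → y ∼ z → Star _∼_ x z
    two-steps x y z x∼y y∼z = x∼y ◅ y⋯z
      where
        y⋯z : Star _∼_ y z
        y⋯z = y∼z ◅ ε

    through-exit : (h≢e : h ≢ e) (h′≢e : h′ ≢ e) → Joins h v a → Joins h′ v b →
                   (vc : Adj G v c) → proj₁ (edge vc) ≢ e → Nonadj a c → Nonadj b c →
                   Star _∼_ (h , h≢e) (h′ , h′≢e)
    through-exit h≢e h′≢e J J′ vc vc≢e ac bc =
      two-steps _ (proj₁ (edge vc) , vc≢e) _
        (gallai-adj J (proj₂ (edge vc)) ac) (gallai-adj (proj₂ (edge vc)) J′ (nonadj-sym bc))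

    through-exits : (h≢e : h ≢ e) (h′≢e : h′ ≢ e) → Joins h v a → Joins h′ v b →
                    TwoExits v (λ c → Nonadj a c × Nonadj b c) → Star _∼_ (h , h≢e) (h′ , h′≢e)
    through-exits h≢e h′≢e J J′ (c , d , c≢d , vc , vd , (ac , bc) , (ad , bd)) with proj₁ (edge vc) ≟ᴱ e
    ... | no vc≢e = through-exit h≢e h′≢e J J′ vc vc≢e ac bc
    ... | yes vc≡e = through-exit h≢e h′≢e J J′ vd vd≢e ad bd
      where
        vd≢e : proj₁ (edge vd) ≢ e
        vd≢e vd≡e = joins-≢ (proj₂ (edge vc)) (proj₂ (edge vd)) c≢d (trans vc≡e (≡-sym vd≡e))

    incident-connected : (h≢e : h ≢ e) (h′≢e : h′ ≢ e) → Joins h v a → Joins h′ v b →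
                         Star _∼_ (h , h≢e) (h′ , h′≢e)
    incident-connected {a = a} {b = b} h≢e h′≢e J J′ with a ≟ b | adj G a b in ab
    -- Here h ≡ h′, but two proofs of h ≢ e need not be equal without function
    -- extensionality, so the path still has to leave h.
    ... | yes refl | _ = through-exits h≢e h′≢e J J′ (two-exits-map (λ ac → ac , ac) (at-edge (adjacent J)))
    ... | no a≢b | true = through-exits h≢e h′≢e J J′ (at-triangle (adjacent J) (adjacent J′) ab)
    ... | no a≢b | false = gallai-adj J J′ (a≢b , Bool.not-¬ ab) ◅ ε

    Reaches : Node → Fin n → Set
    Reaches x p = ∃ λ y → p ∈ᴱ proj₁ y × Star _∼_ x y

    reaches-step : ∀ {x} → AdjWithout e u v → Reaches x u → Reaches x v
    reaches-step {u = u} {v = v} (uv , ¬both) ((h , h≢e) , u∈h , path) =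
      (proj₁ (edge uv) , uv≢e) , right∈ J , path ◅◅ incident-connected h≢e uv≢e (proj₂ (joins u∈h)) J
      where
        J : Joins (proj₁ (edge uv)) u v
        J = proj₂ (edge uv)
        uv≢e : proj₁ (edge uv) ≢ e
        uv≢e refl = ¬both (left∈ J , right∈ J)

    reaches-walk : ∀ {x} → Star (AdjWithout e) u v → Reaches x u → Reaches x v
    reaches-walk ε = λ r → r
    reaches-walk (uw ◅ walk) = reaches-walk walk ∘ reaches-step uw

    connected : (∀ u v → Star (AdjWithout e) u v) → Connected Node _∼_
    connected connected-without x@(((a , _) , _) , _) y@(((c , _) , _) , _)
      with reaches-walk (connected-without a c) (x , inj₁ refl , ε)
    ... | z , c∈z , path = path ◅◅ incident-connected (proj₂ z) (proj₂ y) (proj₂ (joins c∈z)) (proj₂ (joins (inj₁ refl)))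

  triangle-free-exits : TriangleFree → (∀ v → 3 ≤ degree G v) → Exits
  triangle-free-exits no-triangle deg = record
    { at-edge = at-edge
    ; at-triangle = λ va vb ab → ⊥-elim (no-triangle va ab vb)
    }
    where
      at-edge : Adj G v a → TwoExits v (Nonadj a)
      at-edge {v} {a} va with neighbour-avoiding (deg v) a a
      ... | c , vc , c≢a , _ with neighbour-avoiding (deg v) a c
      ...   | d , vd , d≢a , d≢c = c , d , d≢c ∘ ≡-sym , vc , vd , exit vc c≢a , exit vd d≢a
        where
          exit : Adj G v w → w ≢ a → Nonadj a w
          exit vw w≢a = w≢a ∘ ≡-sym , λ aw → no-triangle va aw vw

  triangle-free-bridgeless : TriangleFree → (∀ v → 3 ≤ degree G v) →
                             (∀ {u v} → Nonadj u v → ∃ λ w → Adj G u w × Adj G v w) → Bridgeless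
  triangle-free-bridgeless no-triangle deg common e@((p , q) , _ , pq)
    with x , px , x≢q , _ ← neighbour-avoiding (deg p) q q
    with z , xz , z≢p , _ ← neighbour-avoiding (deg x) p p
    = off-right e px x∉e ◅ off-left e xz x∉e ◅ z⋯q
    where
      x∉e : ¬ x ∈ᴱ e
      x∉e = [ adj⇒≢ px ∘ ≡-sym , x≢q ]′
      z≢q : z ≢ q
      z≢q refl = no-triangle pq (adj-sym xz) px
      z∉e : ¬ z ∈ᴱ e
      z∉e = [ z≢p , z≢q ]′
      z⋯q : Star (AdjWithout e) z q
      z⋯q with adj G z q in zq
      ... | true = off-left e zq z∉e ◅ ε
      ... | false with y , zy , qy ← common (z≢q , Bool.not-¬ zq)
        = off-left e zy z∉e ◅ off-left e (adj-sym qy) y∉e ◅ ε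
        where
          y∉e : ¬ y ∈ᴱ e
          y∉e = [ (λ { refl → no-triangle px xz (adj-sym zy) }) , adj⇒≢ qy ∘ ≡-sym ]′

  module UniqueTriangles
    (on-triangle : ∀ {u v} → Adj G u v → ∃ λ w → Adj G u w × Adj G v w)
    (third-unique : ∀ {u v w w′} → Adj G u v → Adj G u w → Adj G v w → Adj G u w′ → Adj G v w′ → w ≡ w′)
    where

    bridgeless : Bridgeless
    bridgeless e@((p , q) , _ , pq) with w , pw , qw ← on-triangle pq =
      off-right e pw w∉e ◅ off-left e (adj-sym qw) w∉e ◅ ε
      where
        w∉e : ¬ w ∈ᴱ e
        w∉e = [ adj⇒≢ pw ∘ ≡-sym , adj⇒≢ qw ∘ ≡-sym ]′

    off-triangle : Adj G v x → Adj G v y → Adj G x y → Adj G v w → w ≢ y → ¬ Adj G x w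
    off-triangle vx vy xy vw w≢y xw = w≢y (third-unique vx vw xw vy xy)

    -- c is a neighbour of v outside the triangle vab, and d the third vertex of the triangle on vc.
    exits : (∀ v → 3 ≤ degree G v) → Exits
    exits deg = record
      { at-edge = λ va → let _ , vb , ab = on-triangle va in two-exits-map proj₁ (at-triangle va vb ab)
      ; at-triangle = at-triangle
      }
      where
        at-triangle : Adj G v a → Adj G v b → Adj G a b → TwoExits v (λ c → Nonadj a c × Nonadj b c)
        at-triangle {v} {a} {b} va vb ab
          with c , vc , c≢a , c≢b ← neighbour-avoiding (deg v) a b
          with d , vd , cd ← on-triangle vc
          = c , d , adj⇒≢ cd , vc , vd ,
            ((c≢a ∘ ≡-sym , ¬ac) , (c≢b ∘ ≡-sym , ¬bc)) ,
            ((d≢a ∘ ≡-sym , off-triangle va vb ab vd d≢b) , (d≢b ∘ ≡-sym , off-triangle vb va (adj-sym ab) vd d≢a))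
          where
            ¬ac : ¬ Adj G a c
            ¬ac = off-triangle va vb ab vc c≢b
            ¬bc : ¬ Adj G b c
            ¬bc = off-triangle vb va (adj-sym ab) vc c≢a
            d≢a : d ≢ a
            d≢a refl = ¬ac (adj-sym cd)
            d≢b : d ≢ b
            d≢b refl = ¬bc (adj-sym cd)

  distance-two-pair : Star (Adj G) a b → Nonadj a b → ∃ λ x → ∃₂ λ y w → Nonadj x y × Adj G x w × Adj G y w
  distance-two-pair ε (a≢a , _) = ⊥-elim (a≢a refl)
  distance-two-pair {a} {b} (_◅_ {j = w} aw walk) ab with adj G w b in wb | w ≟ b
  ... | true | _ = a , b , w , ab , aw , adj-sym wb
  ... | false | yes refl = ⊥-elim (proj₂ ab aw)
  ... | false | no w≢b = distance-two-pair walk (w≢b , Bool.not-¬ wb)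

  edge-avoiding : (∀ v → 3 ≤ degree G v) → (h h′ : Edge G) → ∃ λ e → h ≢ e × h′ ≢ e
  edge-avoiding deg h@((a , b) , _) h′@((c , d) , _) with a ≟ c
  ... | yes refl with w , aw , w≢b , w≢d ← neighbour-avoiding (deg a) b d =
    proj₁ (edge aw) ,
    joins-≢ (proj₂ (joins {h = h} (inj₁ refl))) (proj₂ (edge aw)) (w≢b ∘ ≡-sym) ,
    joins-≢ (proj₂ (joins {h = h′} (inj₁ refl))) (proj₂ (edge aw)) (w≢d ∘ ≡-sym)
  ... | no a≢c with w , aw , w≢b , w≢c ← neighbour-avoiding (deg a) b c =
    proj₁ (edge aw) ,
    joins-≢ (proj₂ (joins {h = h} (inj₁ refl))) (proj₂ (edge aw)) (w≢b ∘ ≡-sym) ,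
    ∉-endpoint⇒≢ {h = h′} (inj₁ refl) ([ a≢c ∘ ≡-sym , w≢c ∘ ≡-sym ]′ ∘ endpoint (proj₂ (edge aw)))

module StronglyRegular {n : ℕ} (G : Graph n) {k l m : ℕ} (srg : IsSRG G k l m) where
  open Graphs G

  private
    variable
      u v w w′ : Fin n

    adjacent-common : Adj G u v → commonNbrs G u v ≡ l
    adjacent-common = proj₁ (proj₂ (proj₂ (proj₂ srg))) _ _

    nonadjacent-common : Nonadj u v → commonNbrs G u v ≡ m
    nonadjacent-common uv = proj₂ (proj₂ (proj₂ (proj₂ srg))) _ _ (proj₁ uv) (nonadj⇒adj≡false uv)

  degree≥3 : 3 ≤ k → ∀ v → 3 ≤ degree G v
  degree≥3 3≤k v = subst (3 ≤_) (≡-sym (proj₁ srg v)) 3≤k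

  λ≡0⇒triangle-free : l ≡ 0 → TriangleFree
  λ≡0⇒triangle-free l≡0 xy yz xz =
    1+n≰n (subst (1 ≤_) (trans (adjacent-common xy) l≡0) (one≤commonNbrs xz yz))

  λ≡1⇒on-triangle : l ≡ 1 → Adj G u v → ∃ λ w → Adj G u w × Adj G v w
  λ≡1⇒on-triangle l≡1 uv = common-neighbour (subst (1 ≤_) (≡-sym (trans (adjacent-common uv) l≡1)) ≤-refl)

  λ≡1⇒third-unique : l ≡ 1 → Adj G u v → Adj G u w → Adj G v w → Adj G u w′ → Adj G v w′ → w ≡ w′
  λ≡1⇒third-unique {w = w} {w′ = w′} l≡1 uv uw vw uw′ vw′ with w ≟ w′
  ... | yes w≡w′ = w≡w′
  ... | no w≢w′ =
    ⊥-elim (1+n≰n (subst (2 ≤_) (trans (adjacent-common uv) l≡1) (two≤commonNbrs uw vw uw′ vw′ w≢w′)))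

  μ-positive : GraphConnected G → 1 ≤ m
  μ-positive connected
    with u , v , u≢v , uv≡false ← proj₁ (proj₂ srg)
    with x , y , w , xy , xw , yw ← distance-two-pair (connected u v) (u≢v , Bool.not-¬ uv≡false)
    = subst (1 ≤_) (nonadjacent-common xy) (one≤commonNbrs xw yw)

  nonadjacent⇒common-neighbour : GraphConnected G → Nonadj u v → ∃ λ w → Adj G u w × Adj G v w
  nonadjacent⇒common-neighbour connected uv =
    common-neighbour (subst (1 ≤_) (≡-sym (nonadjacent-common uv)) (μ-positive connected))

  exits-and-bridgeless : GraphConnected G → 3 ≤ k → l ≡ 0 ⊎ l ≡ 1 → Exits × Bridgeless
  exits-and-bridgeless connected 3≤k (inj₁ l≡0) =
    triangle-free-exits (λ≡0⇒triangle-free l≡0) (degree≥3 3≤k) ,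
    triangle-free-bridgeless (λ≡0⇒triangle-free l≡0) (degree≥3 3≤k) (nonadjacent⇒common-neighbour connected)
  exits-and-bridgeless connected 3≤k (inj₂ l≡1) = exits (degree≥3 3≤k) , bridgeless
    where open UniqueTriangles (λ≡1⇒on-triangle l≡1) (λ≡1⇒third-unique l≡1)

theorem5 : (n k l m : ℕ) (G : Graph n) → IsSRG G k l m → GraphConnected G → 3 ≤ k → (l ≡ 0 ⊎ l ≡ 1) → TwoConnected (Edge G) (GallaiAdj G)
theorem5 n k l m G srg connected 3≤k λ≤1 =
  connected-if-deletions-connected (edge-avoiding (degree≥3 3≤k)) connected-without , connected-without
  where
    open Graphs G
    open StronglyRegular G srg

    connected-without : ∀ e → Connected (Σ (Edge G) (λ h → h ≢ e)) (λ x y → GallaiAdj G (proj₁ x) (proj₁ y))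
    connected-without e with exits , bridgeless ← exits-and-bridgeless connected 3≤k λ≤1 =
      GallaiWithout.connected exits e (connected-without-edge connected bridgeless e)
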